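{- Let $p>3$ be a prime, $G=D_{2p}$ the dihedral group of order $2p$, and $k\ge2$. Then \[p^k\bigl((p-1)+2^k\bigr)\le\rho_k\le p^k\bigl((p-1)+2^{k+1}\bigr),\] where $\rho_k=\sum_{\vec x\in G^k}|\mathrm{Stab}(\vec x)|$.
   Context: $\mathrm{Stab}(\vec x)=\{\varphi\in\mathrm{Aut}(G):\varphi(x_i)=x_i\text{ for all }i\}$ for $\vec x=(x_1,\dots,x_k)\in G^k$. -}

module Defs where

open import Data.Nat using (ℕ; zero; suc; _+_; _∸_; NonZero)
open import Data.Nat.DivMod using (_mod_)
open import Data.Bool using (Bool; true; false; if_then_else_; _xor_)
import Data.Bool.Properties as BoolP
open import Data.Fin using (Fin; toℕ)
import Data.Fin.Properties as FinP
open import Data.Product using (_×_; _,_)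
open import Data.Product.Properties using (≡-dec)
open import Data.List using (List; []; _∷_; [_]; map; concatMap; allFin; filter; length)
open import Data.Nat.ListAction using (sum)
open import Data.List.Relation.Unary.All using (All; all?)
open import Data.List.Relation.Unary.Any using (Any; any?)
open import Data.Vec using (Vec; lookup; toList) renaming ([] to []ᵥ; _∷_ to _∷ᵥ_)
open import Relation.Binary.PropositionalEquality using (_≡_)
open import Relation.Binary.Definitions using (DecidableEquality)
open import Relation.Nullary using (Dec)
open import Relation.Nullary.Decidable using (_×-dec_; _→-dec_)

-- The dihedral group D_{2p} of order 2p: the pair (i , b) stands for r^i s^b,
-- where r is the rotation of order p and s a reflection, s r s = r^{-1}.
D : ℕ → Set
D p = Fin p × Bool

module Dihedral (p : ℕ) .{{_ : NonZero p}} where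

  -- (r^i s^a)(r^j s^b) = r^(i + (-1)^a j) s^(a xor b)
  _·_ : D p → D p → D p
  (i , a) · (j , b) =
    ((toℕ i + (if a then p ∸ toℕ j else toℕ j)) mod p) , (a xor b)

  _≟D_ : DecidableEquality (D p)
  _≟D_ = ≡-dec FinP._≟_ BoolP._≟_

  elems : List (D p)
  elems = concatMap (λ i → (i , false) ∷ (i , true) ∷ []) (allFin p)

  allVecs : {A : Set} → (n : ℕ) → List A → List (Vec A n)
  allVecs zero    xs = [ []ᵥ ]
  allVecs (suc n) xs = concatMap (λ x → map (x ∷ᵥ_) (allVecs n xs)) xs

  -- every self-map of D_{2p}, given by its table of values:
  -- (v , w) sends r^i to v[i] and r^i s to w[i]
  SelfMap : Set
  SelfMap = Vec (D p) p × Vec (D p) p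

  apply : SelfMap → D p → D p
  apply (v , w) (i , b) = lookup (if b then w else v) i

  allSelfMaps : List SelfMap
  allSelfMaps = concatMap (λ v → map (v ,_) (allVecs p elems)) (allVecs p elems)

  IsHom : SelfMap → Set
  IsHom φ = All (λ g → All (λ h → apply φ (g · h) ≡ apply φ g · apply φ h) elems) elems

  IsInjective : SelfMap → Set
  IsInjective φ = All (λ g → All (λ h → apply φ g ≡ apply φ h → g ≡ h) elems) elems

  IsSurjective : SelfMap → Set
  IsSurjective φ = All (λ y → Any (λ x → apply φ x ≡ y) elems) elems

  IsAut : SelfMap → Set
  IsAut φ = IsHom φ × IsInjective φ × IsSurjective φ

  Fixes : {k : ℕ} → Vec (D p) k → SelfMap → Set
  Fixes xs φ = All (λ x → apply φ x ≡ x) (toList xs)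

  InStab : {k : ℕ} → Vec (D p) k → SelfMap → Set
  InStab xs φ = IsAut φ × Fixes xs φ

  inStab? : {k : ℕ} (xs : Vec (D p) k) (φ : SelfMap) → Dec (InStab xs φ)
  inStab? xs φ =
    (all? (λ g → all? (λ h → apply φ (g · h) ≟D (apply φ g · apply φ h)) elems) elems
     ×-dec (all? (λ g → all? (λ h → (apply φ g ≟D apply φ h) →-dec (g ≟D h)) elems) elems
     ×-dec all? (λ y → any? (λ x → apply φ x ≟D y) elems) elems))
    ×-dec all? (λ x → apply φ x ≟D x) (toList xs)

  stabSize : {k : ℕ} → Vec (D p) k → ℕ
  stabSize xs = length (filter (inStab? xs) allSelfMaps)

  ρ : ℕ → ℕ
  ρ k = sum (map stabSize (allVecs k elems))

-- Counting the pairs (x⃗ , φ) with φ ∈ Stab(x⃗) by φ first gives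
-- ρ_k = Σ_{φ ∈ Aut(G)} |Fix φ|^k.  For p > 2 an automorphism sends r to a rotation r^A
-- with A ≢ 0 and s to a reflection r^B s, hence r^i ↦ r^(A i) and r^i s ↦ r^(A i + B) s,
-- and it is determined by (A , B).  If A = 1 it fixes all p rotations and, unless B = 0,
-- no reflection; if A ≠ 1 each of i ↦ A i and i ↦ A i + B has at most one fixed point
-- modulo the prime p.  The lower bound comes from the p automorphisms with A = 1; for the
-- upper bound each of the p² pairs (A , B) contributes at most (2p)^k, p^k or 2^k.

module Submission where

open import Defs
open import Level using (Level)
open import Data.Bool using (Bool; true; false; if_then_else_)
open import Data.Fin using (Fin; toℕ)
open import Data.Fin.Properties using (toℕ-injective; toℕ-fromℕ<; toℕ<n) renaming (_≟_ to _≟ᶠ_)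
open import Data.List using (List; []; _∷_; _++_; map; concatMap; filter; length; allFin; cartesianProduct; cartesianProductWith)
open import Data.List.Properties using (map-∘; map-++; map-tabulate; length-tabulate)
open import Data.List.Membership.Propositional using (_∈_; lose)
open import Data.List.Membership.Propositional.Properties using (∈-allFin; ∈-cartesianProductWith⁺; ∈-cartesianProduct⁺)
open import Data.List.Relation.Unary.All as All using (All; []; _∷_; all?)
open import Data.List.Relation.Unary.Any using (here; there; any?)
open import Data.List.Relation.Unary.Unique.Propositional using (Unique; []; _∷_)
open import Data.List.Relation.Unary.Unique.Propositional.Properties using (allFin⁺; cartesianProductWith⁺; cartesianProduct⁺)
open import Data.Nat using (ℕ; zero; suc; _+_; _*_; _∸_; _^_; _≤_; _<_; _%_; z≤n; s≤s; NonZero; >-nonZero; >-nonZero⁻¹)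
open import Data.Nat.DivMod using (_mod_; m%n<n; m<n⇒m%n≡m; m%n≤n; m%n%n≡m%n; n%n≡0; %-distribˡ-+)
open import Data.Nat.Divisibility using (_∣_; m%n≡0⇒n∣m; ∣⇒≤)
open import Data.Nat.ListAction using (sum)
open import Data.Nat.ListAction.Properties using (sum-++)
open import Data.Nat.Primality using (Prime; euclidsLemma)
open import Data.Nat.Properties
open import Algebra.Properties.CommutativeSemigroup +-commutativeSemigroup
  using (xy∙z≈xz∙y) renaming (interchange to +-interchange)
open import Algebra.Properties.CommutativeSemigroup *-commutativeSemigroup
  using () renaming (interchange to *-interchange)
open import Data.Nat.Tactic.RingSolver using (solve-∀)
open import Data.Product using (_×_; _,_; proj₁; proj₂)
open import Data.Product.Properties using (≡-dec)
open import Data.Sum using (inj₁; inj₂)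
open import Data.Vec using (Vec; lookup; tabulate; toList) renaming ([] to []ᵥ; _∷_ to _∷ᵥ_)
open import Data.Vec.Properties using (∷-injective; lookup∘tabulate; tabulate∘lookup; tabulate-cong)
open import Function using (_on_)
open import Function.Definitions using (Injective)
open import Relation.Binary.Bundles using (Setoid)
open import Relation.Binary.Definitions using (DecidableEquality)
open import Relation.Binary.PropositionalEquality
import Relation.Binary.Construct.On as On
import Relation.Binary.Reasoning.Setoid as SetoidReasoning
open import Relation.Nullary using (Dec; does; yes; no; ¬_; contradiction)
open import Relation.Nullary.Decidable using (_×-dec_; _→-dec_)
open import Relation.Unary using (Pred; Decidable)

𝟙 : ∀ {ℓ} {P : Set ℓ} → Dec P → ℕ
𝟙 P? = if does P? then 1 else 0

𝟙≤1 : ∀ {ℓ} {P : Set ℓ} (P? : Dec P) → 𝟙 P? ≤ 1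
𝟙≤1 (yes _) = ≤-refl
𝟙≤1 (no _)  = z≤n

𝟙-yes : ∀ {ℓ} {P : Set ℓ} (P? : Dec P) → P → 𝟙 P? ≡ 1
𝟙-yes (yes _) _ = refl
𝟙-yes (no ¬p) p = contradiction p ¬p

𝟙-no : ∀ {ℓ} {P : Set ℓ} (P? : Dec P) → ¬ P → 𝟙 P? ≡ 0
𝟙-no (yes p) ¬p = contradiction p ¬p
𝟙-no (no _)  _  = refl

𝟙-×-dec : ∀ {ℓ ℓ′} {P : Set ℓ} {Q : Set ℓ′} (P? : Dec P) (Q? : Dec Q) →
  𝟙 (P? ×-dec Q?) ≡ 𝟙 P? * 𝟙 Q?
𝟙-×-dec (yes _) Q? = sym (+-identityʳ (𝟙 Q?))
𝟙-×-dec (no _)  Q? = refl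

module _ {A : Set} where

  ∑ : List A → (A → ℕ) → ℕ
  ∑ xs f = sum (map f xs)

  syntax ∑ xs (λ x → e) = ∑[ x ∈ xs ] e

  ∑-cong : ∀ xs {f g : A → ℕ} → (∀ x → f x ≡ g x) → ∑ xs f ≡ ∑ xs g
  ∑-cong []       f≗g = refl
  ∑-cong (x ∷ xs) f≗g = cong₂ _+_ (f≗g x) (∑-cong xs f≗g)

  ∑-mono-≤ : ∀ xs {f g : A → ℕ} → (∀ x → f x ≤ g x) → ∑ xs f ≤ ∑ xs g
  ∑-mono-≤ []       f≤g = z≤n
  ∑-mono-≤ (x ∷ xs) f≤g = +-mono-≤ (f≤g x) (∑-mono-≤ xs f≤g)

  ∑-const : ∀ xs c → ∑[ _ ∈ xs ] c ≡ length xs * c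
  ∑-const []       c = refl
  ∑-const (x ∷ xs) c = cong (c +_) (∑-const xs c)

  ∑-zero : ∀ xs → ∑[ _ ∈ xs ] 0 ≡ 0
  ∑-zero xs = trans (∑-const xs 0) (*-zeroʳ (length xs))

  ∑-+ : ∀ xs (f g : A → ℕ) → ∑[ x ∈ xs ] (f x + g x) ≡ ∑ xs f + ∑ xs g
  ∑-+ []       f g = refl
  ∑-+ (x ∷ xs) f g = begin
    f x + g x + ∑[ x ∈ xs ] (f x + g x) ≡⟨ cong (f x + g x +_) (∑-+ xs f g) ⟩
    f x + g x + (∑ xs f + ∑ xs g)       ≡⟨ +-interchange (f x) (g x) (∑ xs f) (∑ xs g) ⟩
    f x + ∑ xs f + (g x + ∑ xs g)       ∎
    where open ≡-Reasoning

  ∑-*ˡ : ∀ xs c (f : A → ℕ) → ∑[ x ∈ xs ] (c * f x) ≡ c * ∑ xs f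
  ∑-*ˡ []       c f = sym (*-zeroʳ c)
  ∑-*ˡ (x ∷ xs) c f = trans (cong (c * f x +_) (∑-*ˡ xs c f)) (sym (*-distribˡ-+ c (f x) (∑ xs f)))

  ∑-*ʳ : ∀ xs c (f : A → ℕ) → ∑[ x ∈ xs ] (f x * c) ≡ ∑ xs f * c
  ∑-*ʳ []       c f = refl
  ∑-*ʳ (x ∷ xs) c f = trans (cong (f x * c +_) (∑-*ʳ xs c f)) (sym (*-distribʳ-+ c (f x) (∑ xs f)))

  ∑-++ : ∀ xs ys (f : A → ℕ) → ∑ (xs ++ ys) f ≡ ∑ xs f + ∑ ys f
  ∑-++ xs ys f = trans (cong sum (map-++ f xs ys)) (sum-++ (map f xs) (map f ys))

  ∑-≥-∈ : ∀ {xs} (f : A → ℕ) {x} → x ∈ xs → f x ≤ ∑ xs f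
  ∑-≥-∈ f (here refl) = m≤m+n _ _
  ∑-≥-∈ {y ∷ _} f (there x∈xs) = ≤-trans (∑-≥-∈ f x∈xs) (m≤n+m _ (f y))

  length-filter≡∑𝟙 : ∀ {ℓ} {P : Pred A ℓ} (P? : Decidable P) xs →
    length (filter P? xs) ≡ ∑[ x ∈ xs ] 𝟙 (P? x)
  length-filter≡∑𝟙 P? []       = refl
  length-filter≡∑𝟙 P? (x ∷ xs) with P? x
  ... | yes _ = cong suc (length-filter≡∑𝟙 P? xs)
  ... | no _  = length-filter≡∑𝟙 P? xs

  module _ {ℓ} {P : Pred A ℓ} (P? : Decidable P) where

    ∑𝟙-≤-unique : ∀ {xs} → Unique xs → (∀ {x y} → P x → P y → x ≡ y) →
      (f : A → ℕ) {c : ℕ} → (∀ {x} → P x → f x ≤ c) → ∑[ x ∈ xs ] (𝟙 (P? x) * f x) ≤ c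
    ∑𝟙-≤-unique []               P-unique f f≤c = z≤n
    ∑𝟙-≤-unique {x ∷ xs} (x≢xs ∷ xs!) P-unique f {c} f≤c with P? x
    ... | no _   = ∑𝟙-≤-unique xs! P-unique f f≤c
    ... | yes Px = begin
      f x + 0 + ∑[ y ∈ xs ] (𝟙 (P? y) * f y) ≡⟨ cong (f x + 0 +_) (∑𝟙-none others-not-P) ⟩
      f x + 0 + 0                           ≡⟨ +-identityʳ _ ⟩
      f x + 0                               ≡⟨ +-identityʳ _ ⟩
      f x                                   ≤⟨ f≤c Px ⟩
      c                                     ∎
      where
      open ≤-Reasoning
      others-not-P : All (λ y → ¬ P y) xs
      others-not-P = All.map (λ x≢y Py → x≢y (P-unique Px Py)) x≢xs
      ∑𝟙-none : ∀ {ys} → All (λ y → ¬ P y) ys → ∑[ y ∈ ys ] (𝟙 (P? y) * f y) ≡ 0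
      ∑𝟙-none []            = refl
      ∑𝟙-none (¬Py ∷ ¬Pys) = cong₂ _+_ (cong (_* f _) (𝟙-no (P? _) ¬Py)) (∑𝟙-none ¬Pys)

    ∑𝟙-≤1-unique : ∀ {xs} → Unique xs → (∀ {x y} → P x → P y → x ≡ y) → ∑[ x ∈ xs ] 𝟙 (P? x) ≤ 1
    ∑𝟙-≤1-unique {xs} xs! P-unique = ≤-trans (≤-reflexive (∑-cong xs (λ x → sym (*-identityʳ (𝟙 (P? x))))))
                                             (∑𝟙-≤-unique xs! P-unique (λ _ → 1) (λ _ → ≤-refl))

  ∑𝟙-≡-unique : (_≟_ : DecidableEquality A) {xs : List A} → Unique xs → ∀ {x} → x ∈ xs →
    ∀ c → ∑[ y ∈ xs ] (𝟙 (x ≟ y) * c) ≡ c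
  ∑𝟙-≡-unique _≟_ xs! {x} x∈xs c = ≤-antisym
    (∑𝟙-≤-unique (x ≟_) xs! (λ x≡y x≡z → trans (sym x≡y) x≡z) (λ _ → c) (λ _ → ≤-refl))
    (≤-trans (≤-reflexive (sym x-term)) (∑-≥-∈ (λ y → 𝟙 (x ≟ y) * c) x∈xs))
    where
    x-term : 𝟙 (x ≟ x) * c ≡ c
    x-term = trans (cong (_* c) (𝟙-yes (x ≟ x) refl)) (*-identityˡ c)

module _ {A B : Set} where

  ∑-map : ∀ xs (h : A → B) (f : B → ℕ) → ∑ (map h xs) f ≡ ∑[ x ∈ xs ] f (h x)
  ∑-map xs h f = cong sum (sym (map-∘ xs))

  ∑-concatMap : ∀ xs (g : A → List B) (f : B → ℕ) →
    ∑ (concatMap g xs) f ≡ ∑[ x ∈ xs ] ∑ (g x) f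
  ∑-concatMap []       g f = refl
  ∑-concatMap (x ∷ xs) g f =
    trans (∑-++ (g x) (concatMap g xs) f) (cong (∑ (g x) f +_) (∑-concatMap xs g f))

  ∑-comm : ∀ xs ys (f : A → B → ℕ) → ∑[ x ∈ xs ] ∑[ y ∈ ys ] f x y ≡ ∑[ y ∈ ys ] ∑[ x ∈ xs ] f x y
  ∑-comm []       ys f = sym (∑-zero ys)
  ∑-comm (x ∷ xs) ys f = trans (cong (∑ ys (f x) +_) (∑-comm xs ys f))
                               (sym (∑-+ ys (f x) (λ y → ∑[ x ∈ xs ] f x y)))

  ∑-fibres : (_≟_ : DecidableEquality B) {ys : List B} → Unique ys →
    (key : A → B) → (∀ x → key x ∈ ys) → ∀ xs (f : A → ℕ) →
    ∑ xs f ≡ ∑[ y ∈ ys ] ∑[ x ∈ xs ] (𝟙 (key x ≟ y) * f x)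
  ∑-fibres _≟_ {ys} ys! key key∈ xs f = begin
    ∑ xs f                                        ≡⟨ ∑-cong xs (λ x → sym (∑𝟙-≡-unique _≟_ ys! (key∈ x) (f x))) ⟩
    ∑[ x ∈ xs ] ∑[ y ∈ ys ] (𝟙 (key x ≟ y) * f x) ≡⟨ ∑-comm xs ys _ ⟩
    ∑[ y ∈ ys ] ∑[ x ∈ xs ] (𝟙 (key x ≟ y) * f x) ∎
    where open ≡-Reasoning

concatMap-map≡cartesianProductWith : {A B C : Set} (f : A → B → C) (xs : List A) (ys : List B) →
  concatMap (λ x → map (f x) ys) xs ≡ cartesianProductWith f xs ys
concatMap-map≡cartesianProductWith f []       ys = refl
concatMap-map≡cartesianProductWith f (x ∷ xs) ys =
  cong (map (f x) ys ++_) (concatMap-map≡cartesianProductWith f xs ys)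

∑-cartesianProductWith : {A B C : Set} (f : A → B → C) (xs : List A) (ys : List B) (g : C → ℕ) →
  ∑ (cartesianProductWith f xs ys) g ≡ ∑[ x ∈ xs ] ∑[ y ∈ ys ] g (f x y)
∑-cartesianProductWith f xs ys g = begin
  ∑ (cartesianProductWith f xs ys) g              ≡⟨ cong (λ l → ∑ l g) (concatMap-map≡cartesianProductWith f xs ys) ⟨
  ∑ (concatMap (λ x → map (f x) ys) xs) g         ≡⟨ ∑-concatMap xs (λ x → map (f x) ys) g ⟩
  ∑[ x ∈ xs ] ∑ (map (f x) ys) g                  ≡⟨ ∑-cong xs (λ x → ∑-map ys (f x) g) ⟩
  ∑[ x ∈ xs ] ∑[ y ∈ ys ] g (f x y)               ∎
  where open ≡-Reasoning

∑-allFin-const : ∀ n c → ∑[ _ ∈ allFin n ] c ≡ n * c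
∑-allFin-const n c = trans (∑-const (allFin n) c) (cong (_* c) (length-tabulate {n = n} (λ i → i)))

∑-allFin-suc : ∀ n (f : Fin (suc n) → ℕ) → ∑ (allFin (suc n)) f ≡ f Fin.zero + ∑[ i ∈ allFin n ] f (Fin.suc i)
∑-allFin-suc n f = cong (f Fin.zero +_)
  (trans (cong sum (map-tabulate Fin.suc f)) (sym (cong sum (map-tabulate (λ i → i) (λ i → f (Fin.suc i))))))

module Congruence (n : ℕ) .{{_ : NonZero n}} where

  infix 4 _≈_
  _≈_ : ℕ → ℕ → Set
  _≈_ = _≡_ on (_% n)

  ≈-setoid : Setoid _ _
  ≈-setoid = On.setoid (setoid ℕ) (_% n)

  module ≈-Reasoning = SetoidReasoning ≈-setoid

  %-≈ : ∀ x → x % n ≈ x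
  %-≈ x = m%n%n≡m%n x n

  n≈0 : n ≈ 0
  n≈0 = trans (n%n≡0 n) (sym (m<n⇒m%n≡m (>-nonZero⁻¹ n)))

  +-cong : ∀ {a b c d} → a ≈ b → c ≈ d → a + c ≈ b + d
  +-cong {a} {b} {c} {d} a≈b c≈d = begin
    (a + c) % n               ≡⟨ %-distribˡ-+ a c n ⟩
    (a % n + c % n) % n       ≡⟨ cong₂ (λ x y → (x + y) % n) a≈b c≈d ⟩
    (b % n + d % n) % n       ≡⟨ %-distribˡ-+ b d n ⟨
    (b + d) % n               ∎
    where open ≡-Reasoning

  +-congˡ : ∀ a {b c} → b ≈ c → a + b ≈ a + c
  +-congˡ a = +-cong {a} {a} refl

  +-congʳ : ∀ {a b} c → a ≈ b → a + c ≈ b + c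
  +-congʳ c a≈b = +-cong a≈b (refl {x = c % n})

  neg : ℕ → ℕ
  neg x = n ∸ x % n

  neg-inverseˡ : ∀ x → neg x + x ≈ 0
  neg-inverseˡ x = begin
    neg x + x         ≈⟨ +-congˡ (neg x) (sym (%-≈ x)) ⟩
    neg x + x % n     ≡⟨ m∸n+n≡m (m%n≤n x n) ⟩
    n                 ≈⟨ n≈0 ⟩
    0                 ∎
    where open ≈-Reasoning

  +-cancelˡ : ∀ c {a b} → c + a ≈ c + b → a ≈ b
  +-cancelˡ c {a} {b} ca≈cb = begin
    a                  ≈⟨ expand a ⟩
    neg c + (c + a)    ≈⟨ +-congˡ (neg c) ca≈cb ⟩
    neg c + (c + b)    ≈⟨ expand b ⟨
    b                  ∎
    where
    open ≈-Reasoning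
    expand : ∀ x → x ≈ neg c + (c + x)
    expand x = begin
      x                ≈⟨ +-congʳ x (neg-inverseˡ c) ⟨
      neg c + c + x    ≡⟨ +-assoc (neg c) c x ⟩
      neg c + (c + x)  ∎

  +-cancelʳ : ∀ c {a b} → a + c ≈ b + c → a ≈ b
  +-cancelʳ c {a} {b} ac≈bc = +-cancelˡ c (trans (cong (_% n) (+-comm c a)) (trans ac≈bc (cong (_% n) (+-comm b c))))

  neg-+ : ∀ x y → neg x ≈ y + neg (x + y)
  neg-+ x y = +-cancelʳ (x + y) (begin
    neg x + (x + y)              ≡⟨ +-assoc (neg x) x y ⟨
    neg x + x + y                ≈⟨ +-congʳ y (neg-inverseˡ x) ⟩
    y                            ≡⟨ +-identityʳ y ⟨
    y + 0                        ≈⟨ +-congˡ y (neg-inverseˡ (x + y)) ⟨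
    y + (neg (x + y) + (x + y))  ≡⟨ +-assoc y (neg (x + y)) (x + y) ⟨
    y + neg (x + y) + (x + y)    ∎)
    where open ≈-Reasoning

  ≈⇒≡ : ∀ {x y} → x ≈ y → x < n → y < n → x ≡ y
  ≈⇒≡ x≈y x<n y<n = trans (sym (m<n⇒m%n≡m x<n)) (trans x≈y (m<n⇒m%n≡m y<n))

  ≈0⇒∣ : ∀ {x} → x ≈ 0 → n ∣ x
  ≈0⇒∣ {x} x≈0 = m%n≡0⇒n∣m x n (trans x≈0 (m<n⇒m%n≡m (>-nonZero⁻¹ n)))

  ∣∧<⇒≡0 : ∀ {d} → n ∣ d → d < n → d ≡ 0
  ∣∧<⇒≡0 {zero}  _   _   = refl
  ∣∧<⇒≡0 {suc d} n∣d d<n = contradiction (∣⇒≤ n∣d) (<⇒≱ d<n)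

  -- If x ≤ y are both fixed by x ↦ A x + B then (A - 1)(y - x) ≡ 0 (mod n).
  module _ (isPrime : Prime n) {A} (B : ℕ) (2≤A : 2 ≤ A) (A<n : A < n) where

    private
      Ad≈d : ∀ {x d} → A * x + B ≈ x → A * (x + d) + B ≈ x + d → A * d ≈ d
      Ad≈d {x} {d} Ax+B≈x A[x+d]+B≈x+d = +-cancelˡ x (begin
        x + A * d            ≈⟨ +-congʳ (A * d) Ax+B≈x ⟨
        A * x + B + A * d    ≡⟨ distrib A x B d ⟩
        A * (x + d) + B      ≈⟨ A[x+d]+B≈x+d ⟩
        x + d                ∎)
        where
        open ≈-Reasoning
        distrib : ∀ a x b d → a * x + b + a * d ≡ a * (x + d) + b
        distrib = solve-∀

      Ad≈d⇒d≡0 : ∀ {d} → A * d ≈ d → d < n → d ≡ 0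
      Ad≈d⇒d≡0 {d} Ad≈d d<n with euclidsLemma (A ∸ 1) d isPrime (≈0⇒∣ (+-cancelˡ d [A-1]d+d≈d+0))
        where
        [A-1]d+d≈d+0 : d + (A ∸ 1) * d ≈ d + 0
        [A-1]d+d≈d+0 = trans (cong (λ a → (a * d) % n) (m+[n∸m]≡n (≤-trans (s≤s z≤n) 2≤A)))
                             (trans Ad≈d (cong (_% n) (sym (+-identityʳ d))))
      ... | inj₁ n∣A-1 = contradiction (∣⇒≤ {{>-nonZero (m<n⇒0<n∸m 2≤A)}} n∣A-1)
                                       (<⇒≱ (≤-<-trans (m∸n≤m A 1) A<n))
      ... | inj₂ n∣d   = ∣∧<⇒≡0 n∣d d<n

      fixedPoints-ordered : ∀ {x y} → x ≤ y → A * x + B ≈ x → A * y + B ≈ y → y < n → x ≡ y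
      fixedPoints-ordered {x} {y} x≤y Ax+B≈x Ay+B≈y y<n = begin
        x            ≡⟨ +-identityʳ x ⟨
        x + 0        ≡⟨ cong (x +_) d≡0 ⟨
        x + (y ∸ x)  ≡⟨ y≡x+d ⟨
        y            ∎
        where
        open ≡-Reasoning
        y≡x+d : y ≡ x + (y ∸ x)
        y≡x+d = sym (m+[n∸m]≡n x≤y)
        d≡0 : y ∸ x ≡ 0
        d≡0 = Ad≈d⇒d≡0 (Ad≈d Ax+B≈x (subst (λ z → A * z + B ≈ z) y≡x+d Ay+B≈y))
                       (≤-<-trans (m∸n≤m y x) y<n)

    affine-fixedPoint-unique : ∀ {x y} → A * x + B ≈ x → A * y + B ≈ y → x < n → y < n → x ≡ y
    affine-fixedPoint-unique {x} {y} Ax+B≈x Ay+B≈y x<n y<n with ≤-total x y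
    ... | inj₁ x≤y = fixedPoints-ordered x≤y Ax+B≈x Ay+B≈y y<n
    ... | inj₂ y≤x = sym (fixedPoints-ordered y≤x Ay+B≈y Ax+B≈x x<n)

module DihedralGroup (p : ℕ) .{{_ : NonZero p}} where

  open Dihedral p
  open Congruence p

  rot ref : ℕ → D p
  rot m = (m mod p , false)
  ref m = (m mod p , true)

  e r s : D p
  e = rot 0
  r = rot 1
  s = ref 0

  toℕ-mod : ∀ m → toℕ (m mod p) ≈ m
  toℕ-mod m = trans (cong (_% p) (toℕ-fromℕ< (m%n<n m p))) (%-≈ m)

  mod-cong : ∀ {m n} → m ≈ n → m mod p ≡ n mod p
  mod-cong {m} {n} m≈n = toℕ-injective (≈⇒≡ (trans (toℕ-mod m) (trans m≈n (sym (toℕ-mod n)))) (toℕ<n _) (toℕ<n _))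

  mod-injective : ∀ {m n} → m mod p ≡ n mod p → m ≈ n
  mod-injective {m} {n} eq = trans (sym (toℕ-mod m)) (trans (cong (λ i → toℕ i % p) eq) (toℕ-mod n))

  rot-cong : ∀ {m n} → m ≈ n → rot m ≡ rot n
  rot-cong m≈n = cong (_, false) (mod-cong m≈n)

  ref-cong : ∀ {m n} → m ≈ n → ref m ≡ ref n
  ref-cong m≈n = cong (_, true) (mod-cong m≈n)

  rot-injective : ∀ {m n} → rot m ≡ rot n → m ≈ n
  rot-injective eq = mod-injective (cong proj₁ eq)

  ref-injective : ∀ {m n} → ref m ≡ ref n → m ≈ n
  ref-injective eq = mod-injective (cong proj₁ eq)

  toℕ-mod-toℕ : ∀ (i : Fin p) → toℕ i mod p ≡ i
  toℕ-mod-toℕ i = toℕ-injective (≈⇒≡ (toℕ-mod (toℕ i)) (toℕ<n _) (toℕ<n i))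

  rot-toℕ : ∀ i → rot (toℕ i) ≡ (i , false)
  rot-toℕ i = cong (_, false) (toℕ-mod-toℕ i)

  ref-toℕ : ∀ i → ref (toℕ i) ≡ (i , true)
  ref-toℕ i = cong (_, true) (toℕ-mod-toℕ i)

  D-elim : {P : D p → Set} → (∀ m → P (rot m)) → (∀ m → P (ref m)) → ∀ g → P g
  D-elim {P} P-rot P-ref (i , false) = subst P (rot-toℕ i) (P-rot (toℕ i))
  D-elim {P} P-rot P-ref (i , true)  = subst P (ref-toℕ i) (P-ref (toℕ i))

  rot-·-rot : ∀ m n → rot m · rot n ≡ rot (m + n)
  rot-·-rot m n = rot-cong (+-cong (toℕ-mod m) (toℕ-mod n))

  rot-·-ref : ∀ m n → rot m · ref n ≡ ref (m + n)
  rot-·-ref m n = ref-cong (+-cong (toℕ-mod m) (toℕ-mod n))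

  ref-·-rot : ∀ m n → ref m · rot n ≡ ref (m + neg n)
  ref-·-rot m n = ref-cong (+-cong (toℕ-mod m) (cong (λ x → (p ∸ x) % p) (toℕ-fromℕ< (m%n<n n p))))

  ref-·-ref : ∀ m n → ref m · ref n ≡ rot (m + neg n)
  ref-·-ref m n = rot-cong (+-cong (toℕ-mod m) (cong (λ x → (p ∸ x) % p) (toℕ-fromℕ< (m%n<n n p))))

  rotations-commute : ∀ i j → (i , false) · (j , false) ≡ (j , false) · (i , false)
  rotations-commute i j = cong (λ x → x mod p , false) (+-comm (toℕ i) (toℕ j))

  reflection-involutive : ∀ i → (i , true) · (i , true) ≡ e
  reflection-involutive i = subst (λ g → g · g ≡ e) (ref-toℕ i)
    (trans (ref-·-ref (toℕ i) (toℕ i)) (rot-cong (trans (cong (_% p) (+-comm (toℕ i) _)) (neg-inverseˡ (toℕ i)))))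

  idempotent⇒e : ∀ g → g · g ≡ g → g ≡ e
  idempotent⇒e = D-elim rot-idempotent ref-idempotent
    where
    rot-idempotent : ∀ m → rot m · rot m ≡ rot m → rot m ≡ e
    rot-idempotent m eq = rot-cong (+-cancelˡ m (trans (rot-injective (trans (sym (rot-·-rot m m)) eq))
                                                       (cong (_% p) (sym (+-identityʳ m)))))
    ref-idempotent : ∀ m → ref m · ref m ≡ ref m → ref m ≡ e
    ref-idempotent m eq with () ← cong proj₂ eq

  Hom : (D p → D p) → Set
  Hom f = ∀ g h → f (g · h) ≡ f g · f h

  module _ (2<p : 2 < p) where

    2≉0 : ¬ 2 ≈ 0
    2≉0 2≈0 with () ← ≈⇒≡ 2≈0 2<p (≤-trans (s≤s z≤n) 2<p)

    r≢e : r ≢ e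
    r≢e r≡e with () ← ≈⇒≡ (rot-injective r≡e) (≤-trans (s≤s (s≤s z≤n)) 2<p) (≤-trans (s≤s z≤n) 2<p)

    r·r≢e : r · r ≢ e
    r·r≢e r·r≡e = 2≉0 (rot-injective (trans (sym (rot-·-rot 1 1)) r·r≡e))

    s·r≢r·s : s · r ≢ r · s
    s·r≢r·s s·r≡r·s = 2≉0 (begin
      2               ≡⟨⟩
      1 + 1           ≈⟨ +-congʳ 1 (ref-injective (trans (sym (ref-·-rot 0 1)) (trans s·r≡r·s (rot-·-ref 1 0)))) ⟨
      neg 1 + 1       ≈⟨ neg-inverseˡ 1 ⟩
      0               ∎)
      where open ≈-Reasoning

    module Classification {f : D p → D p} (hom : Hom f) (inj : Injective _≡_ _≡_ f) where

      f-e : f e ≡ e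
      f-e = idempotent⇒e (f e) (trans (sym (hom e e)) (cong f (rot-·-rot 0 0)))

      f-r-rotation : proj₂ (f r) ≡ false
      f-r-rotation with f r in f-r≡
      ... | (_ , false) = refl
      ... | (i , true)  = contradiction (inj (begin
        f (r · r)          ≡⟨ hom r r ⟩
        f r · f r          ≡⟨ cong₂ _·_ f-r≡ f-r≡ ⟩
        (i , true) · (i , true) ≡⟨ reflection-involutive i ⟩
        e                  ≡⟨ f-e ⟨
        f e                ∎)) r·r≢e
        where open ≡-Reasoning

      A B : ℕ
      A = toℕ (proj₁ (f r))
      B = toℕ (proj₁ (f s))

      f-r : f r ≡ rot A
      f-r = trans (cong (proj₁ (f r) ,_) f-r-rotation) (sym (rot-toℕ _))

      f-s-reflection : proj₂ (f s) ≡ true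
      f-s-reflection with f s in f-s≡
      ... | (_ , true)  = refl
      ... | (j , false) = contradiction (inj (begin
        f (s · r)                    ≡⟨ hom s r ⟩
        f s · f r                    ≡⟨ cong₂ _·_ f-s≡ f-r′ ⟩
        (j , false) · (proj₁ (f r) , false) ≡⟨ rotations-commute j _ ⟩
        (proj₁ (f r) , false) · (j , false) ≡⟨ cong₂ _·_ f-r′ f-s≡ ⟨
        f r · f s                    ≡⟨ hom r s ⟨
        f (r · s)                    ∎)) s·r≢r·s
        where
        open ≡-Reasoning
        f-r′ : f r ≡ (proj₁ (f r) , false)
        f-r′ = cong (proj₁ (f r) ,_) f-r-rotation

      f-s : f s ≡ ref B
      f-s = trans (cong (proj₁ (f s) ,_) f-s-reflection) (sym (ref-toℕ _))

      A≢0 : A ≢ 0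
      A≢0 A≡0 = r≢e (inj (trans f-r (trans (cong rot A≡0) (sym f-e))))

      f-rot : ∀ m → f (rot m) ≡ rot (A * m)
      f-rot zero    = trans f-e (cong rot (sym (*-zeroʳ A)))
      f-rot (suc m) = begin
        f (rot (suc m))          ≡⟨ cong f (trans (cong rot (+-comm 1 m)) (sym (rot-·-rot m 1))) ⟩
        f (rot m · r)            ≡⟨ hom (rot m) r ⟩
        f (rot m) · f r          ≡⟨ cong₂ _·_ (f-rot m) f-r ⟩
        rot (A * m) · rot A      ≡⟨ rot-·-rot (A * m) A ⟩
        rot (A * m + A)          ≡⟨ cong rot (trans (+-comm (A * m) A) (sym (*-suc A m))) ⟩
        rot (A * suc m)          ∎
        where open ≡-Reasoning

      f-ref : ∀ m → f (ref m) ≡ ref (A * m + B)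
      f-ref m = begin
        f (ref m)                ≡⟨ cong f (trans (cong ref (sym (+-identityʳ m))) (sym (rot-·-ref m 0))) ⟩
        f (rot m · s)            ≡⟨ hom (rot m) s ⟩
        f (rot m) · f s          ≡⟨ cong₂ _·_ (f-rot m) f-s ⟩
        rot (A * m) · ref B      ≡⟨ rot-·-ref (A * m) B ⟩
        ref (A * m + B)          ∎
        where open ≡-Reasoning

module Enumerations (p : ℕ) .{{_ : NonZero p}} where

  open Dihedral p

  allVecs≡cartesianProductWith : {A : Set} (n : ℕ) (xs : List A) →
    allVecs (suc n) xs ≡ cartesianProductWith _∷ᵥ_ xs (allVecs n xs)
  allVecs≡cartesianProductWith n xs = concatMap-map≡cartesianProductWith _∷ᵥ_ xs (allVecs n xs)

  allVecs-unique : {A : Set} (n : ℕ) {xs : List A} → Unique xs → Unique (allVecs n xs)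
  allVecs-unique zero    xs! = [] ∷ []
  allVecs-unique (suc n) {xs} xs! = subst Unique (sym (allVecs≡cartesianProductWith n xs))
    (cartesianProductWith⁺ _∷ᵥ_ ∷-injective xs! (allVecs-unique n xs!))

  ∈-allVecs : {A : Set} {xs : List A} → (∀ x → x ∈ xs) → ∀ {n} (v : Vec A n) → v ∈ allVecs n xs
  ∈-allVecs ∈xs []ᵥ       = here refl
  ∈-allVecs {xs = xs} ∈xs {suc n} (x ∷ᵥ v) = subst (_ ∈_) (sym (allVecs≡cartesianProductWith n xs))
    (∈-cartesianProductWith⁺ _∷ᵥ_ (∈xs x) (∈-allVecs ∈xs v))

  ∑𝟙-all-allVecs : {A : Set} {ℓ : Level} {P : Pred A ℓ} (P? : Decidable P) (n : ℕ) (xs : List A) →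
    ∑[ v ∈ allVecs n xs ] 𝟙 (all? P? (toList v)) ≡ (∑[ x ∈ xs ] 𝟙 (P? x)) ^ n
  ∑𝟙-all-allVecs P? zero    xs = refl
  ∑𝟙-all-allVecs P? (suc n) xs = begin
    ∑[ v ∈ allVecs (suc n) xs ] 𝟙 (all? P? (toList v))
      ≡⟨ ∑-concatMap xs _ _ ⟩
    ∑[ x ∈ xs ] ∑[ v ∈ map (x ∷ᵥ_) (allVecs n xs) ] 𝟙 (all? P? (toList v))
      ≡⟨ ∑-cong xs (λ x → ∑-map (allVecs n xs) (x ∷ᵥ_) (λ v → 𝟙 (all? P? (toList v)))) ⟩
    ∑[ x ∈ xs ] ∑[ v ∈ allVecs n xs ] 𝟙 (P? x ×-dec all? P? (toList v))
      ≡⟨ ∑-cong xs (λ x → ∑-cong (allVecs n xs) (λ v → 𝟙-×-dec (P? x) (all? P? (toList v)))) ⟩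
    ∑[ x ∈ xs ] ∑[ v ∈ allVecs n xs ] (𝟙 (P? x) * 𝟙 (all? P? (toList v)))
      ≡⟨ ∑-cong xs (λ x → trans (∑-*ˡ (allVecs n xs) (𝟙 (P? x)) _) (cong (𝟙 (P? x) *_) (∑𝟙-all-allVecs P? n xs))) ⟩
    ∑[ x ∈ xs ] (𝟙 (P? x) * c ^ n)
      ≡⟨ ∑-*ʳ xs (c ^ n) (λ x → 𝟙 (P? x)) ⟩
    c * c ^ n ∎
    where
    open ≡-Reasoning
    c = ∑[ x ∈ xs ] 𝟙 (P? x)

  elems≡cartesianProduct : elems ≡ cartesianProduct (allFin p) (false ∷ true ∷ [])
  elems≡cartesianProduct = concatMap-map≡cartesianProductWith _,_ (allFin p) (false ∷ true ∷ [])

  elems-unique : Unique elems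
  elems-unique = subst Unique (sym elems≡cartesianProduct)
    (cartesianProduct⁺ (allFin⁺ p) (((λ ()) ∷ []) ∷ [] ∷ []))

  ∈-elems : ∀ g → g ∈ elems
  ∈-elems (i , b) = subst (_ ∈_) (sym elems≡cartesianProduct) (∈-cartesianProduct⁺ (∈-allFin i) (∈-bools b))
    where
    ∈-bools : ∀ b → b ∈ false ∷ true ∷ []
    ∈-bools false = here refl
    ∈-bools true  = there (here refl)

  allSelfMaps≡cartesianProduct : allSelfMaps ≡ cartesianProduct (allVecs p elems) (allVecs p elems)
  allSelfMaps≡cartesianProduct = concatMap-map≡cartesianProductWith _,_ (allVecs p elems) (allVecs p elems)

  allSelfMaps-unique : Unique allSelfMaps
  allSelfMaps-unique = subst Unique (sym allSelfMaps≡cartesianProduct)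
    (cartesianProduct⁺ (allVecs-unique p elems-unique) (allVecs-unique p elems-unique))

  ∈-allSelfMaps : ∀ φ → φ ∈ allSelfMaps
  ∈-allSelfMaps (v , w) = subst (_ ∈_) (sym allSelfMaps≡cartesianProduct)
    (∈-cartesianProduct⁺ (∈-allVecs ∈-elems v) (∈-allVecs ∈-elems w))

module Automorphisms (p : ℕ) .{{_ : NonZero p}} where

  open Dihedral p
  open Congruence p
  open DihedralGroup p
  open Enumerations p

  -- Verbatim the first factor of inStab?, so that 𝟙 (inStab? xs φ) splits as a product.
  isAut? : (φ : SelfMap) → Dec (IsAut φ)
  isAut? φ =
    all? (λ g → all? (λ h → apply φ (g · h) ≟D (apply φ g · apply φ h)) elems) elems
    ×-dec (all? (λ g → all? (λ h → (apply φ g ≟D apply φ h) →-dec (g ≟D h)) elems) elems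
    ×-dec all? (λ y → any? (λ x → apply φ x ≟D y) elems) elems)

  IsAut⇒Hom : ∀ {φ} → IsAut φ → Hom (apply φ)
  IsAut⇒Hom (hom , _) g h = All.lookup (All.lookup hom (∈-elems g)) (∈-elems h)

  IsAut⇒Injective : ∀ {φ} → IsAut φ → Injective _≡_ _≡_ (apply φ)
  IsAut⇒Injective (_ , inj , _) {g} {h} = All.lookup (All.lookup inj (∈-elems g)) (∈-elems h)

  selfMap-ext : ∀ {φ ψ} → (∀ g → apply φ g ≡ apply ψ g) → φ ≡ ψ
  selfMap-ext {v , w} {v′ , w′} φ≗ψ = cong₂ _,_ (vec-ext (λ i → φ≗ψ (i , false))) (vec-ext (λ i → φ≗ψ (i , true)))
    where
    vec-ext : ∀ {n} {u u′ : Vec (D p) n} → (∀ i → lookup u i ≡ lookup u′ i) → u ≡ u′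
    vec-ext {u = u} {u′} u≗u′ = trans (sym (tabulate∘lookup u)) (trans (tabulate-cong u≗u′) (tabulate∘lookup u′))

  tabulateSelfMap : (D p → D p) → SelfMap
  tabulateSelfMap f = tabulate (λ i → f (i , false)) , tabulate (λ i → f (i , true))

  apply-tabulate : ∀ f g → apply (tabulateSelfMap f) g ≡ f g
  apply-tabulate f (i , false) = lookup∘tabulate _ i
  apply-tabulate f (i , true)  = lookup∘tabulate _ i

  isAut-tabulate : ∀ {f f⁻¹ : D p → D p} → Hom f → (∀ g → f⁻¹ (f g) ≡ g) → (∀ g → f (f⁻¹ g) ≡ g) →
    IsAut (tabulateSelfMap f)
  isAut-tabulate {f} {f⁻¹} hom left right =
    All.universal (λ g → All.universal (λ h → hom′ g h) elems) elems ,
    All.universal (λ g → All.universal (λ h → inj g h) elems) elems ,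
    All.universal (λ y → lose (∈-elems (f⁻¹ y)) (trans (apply-tabulate f (f⁻¹ y)) (right y))) elems
    where
    φ = tabulateSelfMap f
    hom′ : ∀ g h → apply φ (g · h) ≡ apply φ g · apply φ h
    hom′ g h = trans (apply-tabulate f (g · h)) (trans (hom g h) (sym (cong₂ _·_ (apply-tabulate f g) (apply-tabulate f h))))
    inj : ∀ g h → apply φ g ≡ apply φ h → g ≡ h
    inj g h eq = trans (sym (left g)) (trans (cong f⁻¹ (trans (sym (apply-tabulate f g)) (trans eq (apply-tabulate f h)))) (left h))

  fixCount : SelfMap → ℕ
  fixCount φ = ∑[ g ∈ elems ] 𝟙 (apply φ g ≟D g)

  ∑-elems : ∀ (f : D p → ℕ) → ∑ elems f ≡ ∑[ i ∈ allFin p ] (f (i , false) + f (i , true))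
  ∑-elems f = trans (∑-concatMap (allFin p) _ f) (∑-cong (allFin p) (λ i → cong (f (i , false) +_) (+-identityʳ _)))

  module _ (φ : SelfMap) where

    private
      fixed? : ∀ g → Dec (apply φ g ≡ g)
      fixed? g = apply φ g ≟D g

      fixCount-bounded : ∀ {c} → (∀ i → 𝟙 (fixed? (i , false)) + 𝟙 (fixed? (i , true)) ≤ c) → fixCount φ ≤ p * c
      fixCount-bounded {c} bound = begin
        fixCount φ ≡⟨ ∑-elems (λ g → 𝟙 (fixed? g)) ⟩
        _          ≤⟨ ∑-mono-≤ (allFin p) bound ⟩
        _          ≡⟨ ∑-allFin-const p c ⟩
        p * c      ∎
        where open ≤-Reasoning

    fixCount-≤ : fixCount φ ≤ p * 2
    fixCount-≤ = fixCount-bounded (λ i → +-mono-≤ (𝟙≤1 (fixed? (i , false))) (𝟙≤1 (fixed? (i , true))))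

    fixCount-≤-no-fixed-reflection : (∀ i → apply φ (i , true) ≢ (i , true)) → fixCount φ ≤ p
    fixCount-≤-no-fixed-reflection no-fixed = ≤-trans
      (fixCount-bounded (λ i → +-mono-≤ (𝟙≤1 (fixed? (i , false))) (≤-reflexive (𝟙-no (fixed? (i , true)) (no-fixed i)))))
      (≤-reflexive (*-identityʳ p))

    FixesAtMostOne : Bool → Set
    FixesAtMostOne b = ∀ {i j} → apply φ (i , b) ≡ (i , b) → apply φ (j , b) ≡ (j , b) → i ≡ j

    fixCount-≤-unique-fixed : FixesAtMostOne false → FixesAtMostOne true → fixCount φ ≤ 2
    fixCount-≤-unique-fixed unique-rot unique-ref = begin
      fixCount φ   ≡⟨ ∑-elems (λ g → 𝟙 (fixed? g)) ⟩
      _            ≡⟨ ∑-+ (allFin p) (λ i → 𝟙 (fixed? (i , false))) (λ i → 𝟙 (fixed? (i , true))) ⟩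
      _            ≤⟨ +-mono-≤ (∑𝟙-≤1-unique (λ i → fixed? (i , false)) (allFin⁺ p) unique-rot)
                               (∑𝟙-≤1-unique (λ i → fixed? (i , true)) (allFin⁺ p) unique-ref) ⟩
      2            ∎
      where open ≤-Reasoning

    fixCount-≥-fixed-rotations : (∀ i → apply φ (i , false) ≡ (i , false)) → p ≤ fixCount φ
    fixCount-≥-fixed-rotations fixed = begin
      p                ≡⟨ *-identityʳ p ⟨
      p * 1            ≡⟨ ∑-allFin-const p 1 ⟨
      ∑[ _ ∈ allFin p ] 1 ≤⟨ ∑-mono-≤ (allFin p) rotation-counted ⟩
      _                ≡⟨ ∑-elems (λ g → 𝟙 (fixed? g)) ⟨
      fixCount φ       ∎
      where
      open ≤-Reasoning
      rotation-counted : ∀ i → 1 ≤ 𝟙 (fixed? (i , false)) + 𝟙 (fixed? (i , true))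
      rotation-counted i = ≤-trans (≤-reflexive (sym (𝟙-yes (fixed? (i , false)) (fixed i)))) (m≤m+n _ _)

    fixCount-≥-identity : (∀ g → apply φ g ≡ g) → p * 2 ≤ fixCount φ
    fixCount-≥-identity fixed = begin
      p * 2            ≡⟨ ∑-allFin-const p 2 ⟨
      ∑[ _ ∈ allFin p ] 2 ≡⟨ ∑-cong (allFin p) both-counted ⟩
      _                ≡⟨ ∑-elems (λ g → 𝟙 (fixed? g)) ⟨
      fixCount φ       ∎
      where
      open ≤-Reasoning
      both-counted : ∀ i → 2 ≡ 𝟙 (fixed? (i , false)) + 𝟙 (fixed? (i , true))
      both-counted i = sym (cong₂ _+_ (𝟙-yes (fixed? (i , false)) (fixed _)) (𝟙-yes (fixed? (i , true)) (fixed _)))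

  key : SelfMap → Fin p × Fin p
  key φ = proj₁ (apply φ r) , proj₁ (apply φ s)

  -- Indexed by the exponents A, B of the images r^A and r^B s of r and s; A = 0 never occurs.
  fixBound : ℕ → ℕ → ℕ
  fixBound 1 0       = p * 2
  fixBound 1 (suc _) = p
  fixBound _ _       = 2

  module _ (2<p : 2 < p) where

    module AutClassification {φ : SelfMap} (aut : IsAut φ) =
      Classification 2<p (IsAut⇒Hom aut) (IsAut⇒Injective aut)

    aut-determined-by-key : ∀ {φ ψ} → IsAut φ → IsAut ψ → key φ ≡ key ψ → φ ≡ ψ
    aut-determined-by-key {φ} {ψ} aut-φ aut-ψ key≡ = selfMap-ext (D-elim agree-rot agree-ref)
      where
      module Φ = AutClassification aut-φ
      module Ψ = AutClassification aut-ψ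
      A≡ : Φ.A ≡ Ψ.A
      A≡ = cong (λ κ → toℕ (proj₁ κ)) key≡
      B≡ : Φ.B ≡ Ψ.B
      B≡ = cong (λ κ → toℕ (proj₂ κ)) key≡
      agree-rot : ∀ m → apply φ (rot m) ≡ apply ψ (rot m)
      agree-rot m = trans (Φ.f-rot m) (trans (cong (λ a → rot (a * m)) A≡) (sym (Ψ.f-rot m)))
      agree-ref : ∀ m → apply φ (ref m) ≡ apply ψ (ref m)
      agree-ref m = trans (Φ.f-ref m) (trans (cong₂ (λ a b → ref (a * m + b)) A≡ B≡) (sym (Ψ.f-ref m)))

    aut-fixCount-≤ : Prime p → ∀ {φ} → IsAut φ → fixCount φ ≤ fixBound (toℕ (proj₁ (key φ))) (toℕ (proj₂ (key φ)))
    aut-fixCount-≤ isPrime {φ} aut = by-cases A B refl refl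
      where
      open AutClassification aut
      fixed-rot : ∀ {i} → apply φ (i , false) ≡ (i , false) → A * toℕ i + 0 ≈ toℕ i
      fixed-rot {i} fixed = trans (cong (_% p) (+-identityʳ _)) (rot-injective (begin
        rot (A * toℕ i)     ≡⟨ f-rot (toℕ i) ⟨
        apply φ (rot (toℕ i)) ≡⟨ cong (apply φ) (rot-toℕ i) ⟩
        apply φ (i , false) ≡⟨ fixed ⟩
        (i , false)         ≡⟨ rot-toℕ i ⟨
        rot (toℕ i)         ∎))
        where open ≡-Reasoning
      fixed-ref : ∀ {i} → apply φ (i , true) ≡ (i , true) → A * toℕ i + B ≈ toℕ i
      fixed-ref {i} fixed = ref-injective (begin
        ref (A * toℕ i + B) ≡⟨ f-ref (toℕ i) ⟨
        apply φ (ref (toℕ i)) ≡⟨ cong (apply φ) (ref-toℕ i) ⟩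
        apply φ (i , true)  ≡⟨ fixed ⟩
        (i , true)          ≡⟨ ref-toℕ i ⟨
        ref (toℕ i)         ∎)
        where open ≡-Reasoning
      by-cases : ∀ a b → A ≡ a → B ≡ b → fixCount φ ≤ fixBound a b
      by-cases zero          _       A≡0 _   = contradiction A≡0 A≢0
      by-cases 1             zero    _   _   = fixCount-≤ φ
      by-cases 1             (suc b) A≡1 B≡b = fixCount-≤-no-fixed-reflection φ (λ i fixed → 1+n≢0 (trans (sym B≡b)
        (≈⇒≡ (+-cancelˡ (toℕ i) (i+B≈i+0 A≡1 fixed)) (toℕ<n _) (≤-trans (s≤s z≤n) 2<p))))
        where
        i+B≈i+0 : ∀ {i} → A ≡ 1 → apply φ (i , true) ≡ (i , true) → toℕ i + B ≈ toℕ i + 0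
        i+B≈i+0 {i} A≡1 fixed = trans (cong (λ a → (a + B) % p) (sym (trans (cong (_* toℕ i) A≡1) (*-identityˡ (toℕ i)))))
                                      (trans (fixed-ref fixed) (cong (_% p) (sym (+-identityʳ (toℕ i)))))
      by-cases (suc (suc a)) _       A≡  _   = fixCount-≤-unique-fixed φ
        (λ fixed-i fixed-j → toℕ-injective (unique 0 (fixed-rot fixed-i) (fixed-rot fixed-j)))
        (λ fixed-i fixed-j → toℕ-injective (unique B (fixed-ref fixed-i) (fixed-ref fixed-j)))
        where
        unique : ∀ b {x y : Fin p} → A * toℕ x + b ≈ toℕ x → A * toℕ y + b ≈ toℕ y → toℕ x ≡ toℕ y
        unique b Ax+b≈x Ay+b≈y = affine-fixedPoint-unique isPrime b (subst (2 ≤_) (sym A≡) (s≤s (s≤s z≤n))) (toℕ<n _)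
                                   Ax+b≈x Ay+b≈y (toℕ<n _) (toℕ<n _)

  shift : ℕ → D p → D p
  shift b (i , false) = (i , false)
  shift b (i , true)  = ref (toℕ i + b)

  shift-ref : ∀ b m → shift b (ref m) ≡ ref (m + b)
  shift-ref b m = ref-cong (+-congʳ b (toℕ-mod m))

  shift-hom : ∀ b → Hom (shift b)
  shift-hom b = D-elim (λ m → D-elim (λ n → refl) (rot-ref m)) (λ m → D-elim (ref-rot m) (ref-ref m))
    where
    open ≡-Reasoning
    rot-ref : ∀ m n → shift b (rot m · ref n) ≡ shift b (rot m) · shift b (ref n)
    rot-ref m n = begin
      shift b (rot m · ref n)  ≡⟨ cong (shift b) (rot-·-ref m n) ⟩
      shift b (ref (m + n))    ≡⟨ shift-ref b (m + n) ⟩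
      ref (m + n + b)          ≡⟨ cong ref (+-assoc m n b) ⟩
      ref (m + (n + b))        ≡⟨ rot-·-ref m (n + b) ⟨
      rot m · ref (n + b)      ≡⟨ cong (rot m ·_) (shift-ref b n) ⟨
      rot m · shift b (ref n)  ∎
    ref-rot : ∀ m n → shift b (ref m · rot n) ≡ shift b (ref m) · shift b (rot n)
    ref-rot m n = begin
      shift b (ref m · rot n)  ≡⟨ cong (shift b) (ref-·-rot m n) ⟩
      shift b (ref (m + neg n)) ≡⟨ shift-ref b (m + neg n) ⟩
      ref (m + neg n + b)      ≡⟨ cong ref (xy∙z≈xz∙y m (neg n) b) ⟩
      ref (m + b + neg n)      ≡⟨ ref-·-rot (m + b) n ⟨
      ref (m + b) · rot n      ≡⟨ cong (_· rot n) (shift-ref b m) ⟨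
      shift b (ref m) · rot n  ∎
    ref-ref : ∀ m n → shift b (ref m · ref n) ≡ shift b (ref m) · shift b (ref n)
    ref-ref m n = begin
      shift b (ref m · ref n)  ≡⟨ cong (shift b) (ref-·-ref m n) ⟩
      rot (m + neg n)          ≡⟨ rot-cong (+-congˡ m (neg-+ n b)) ⟩
      rot (m + (b + neg (n + b))) ≡⟨ cong rot (+-assoc m b _) ⟨
      rot (m + b + neg (n + b)) ≡⟨ ref-·-ref (m + b) (n + b) ⟨
      ref (m + b) · ref (n + b) ≡⟨ cong₂ _·_ (shift-ref b m) (shift-ref b n) ⟨
      shift b (ref m) · shift b (ref n) ∎

  shift-identity : ∀ {b} → b ≈ 0 → ∀ g → shift b g ≡ g
  shift-identity {b} b≈0 = D-elim (λ m → refl) λ m →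
    trans (shift-ref b m) (ref-cong (trans (+-congˡ m b≈0) (cong (_% p) (+-identityʳ m))))

  shift-∘ : ∀ b c g → shift c (shift b g) ≡ shift (b + c) g
  shift-∘ b c = D-elim (λ m → refl) λ m → begin
    shift c (shift b (ref m)) ≡⟨ cong (shift c) (shift-ref b m) ⟩
    shift c (ref (m + b))     ≡⟨ shift-ref c (m + b) ⟩
    ref (m + b + c)           ≡⟨ cong ref (+-assoc m b c) ⟩
    ref (m + (b + c))         ≡⟨ shift-ref (b + c) m ⟨
    shift (b + c) (ref m)     ∎
    where open ≡-Reasoning

  shift-inverse : ∀ {b c} → b + c ≈ 0 → ∀ g → shift c (shift b g) ≡ g
  shift-inverse {b} {c} b+c≈0 g = trans (shift-∘ b c g) (shift-identity b+c≈0 g)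

  shiftMap : Fin p → SelfMap
  shiftMap b = tabulateSelfMap (shift (toℕ b))

  shiftMap-isAut : ∀ b → IsAut (shiftMap b)
  shiftMap-isAut b = isAut-tabulate {f⁻¹ = shift (neg (toℕ b))} (shift-hom (toℕ b))
    (shift-inverse (trans (cong (_% p) (+-comm (toℕ b) _)) (neg-inverseˡ (toℕ b))))
    (shift-inverse (neg-inverseˡ (toℕ b)))

  key-shiftMap : ∀ b → key (shiftMap b) ≡ (proj₁ r , b)
  key-shiftMap b = cong₂ _,_ (cong proj₁ (apply-tabulate (shift (toℕ b)) r))
    (cong proj₁ (trans (apply-tabulate (shift (toℕ b)) s) (trans (shift-ref (toℕ b) 0) (ref-toℕ b))))

  fixCount-shiftMap : ∀ b → p ≤ fixCount (shiftMap b)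
  fixCount-shiftMap b = fixCount-≥-fixed-rotations (shiftMap b) (λ i → apply-tabulate (shift (toℕ b)) (i , false))

  fixCount-shiftMap-identity : ∀ b → toℕ b ≡ 0 → p * 2 ≤ fixCount (shiftMap b)
  fixCount-shiftMap-identity b b≡0 = fixCount-≥-identity (shiftMap b)
    (λ g → trans (apply-tabulate (shift (toℕ b)) g) (shift-identity (cong (_% p) b≡0) g))

module Fibres (p : ℕ) .{{_ : NonZero p}} (k : ℕ) where

  open Dihedral p
  open DihedralGroup p
  open Enumerations p
  open Automorphisms p

  weight : SelfMap → ℕ
  weight φ = 𝟙 (isAut? φ) * fixCount φ ^ k

  ρ≡∑weight : ρ k ≡ ∑ allSelfMaps weight
  ρ≡∑weight = begin
    ∑[ xs ∈ allVecs k elems ] length (filter (inStab? xs) allSelfMaps)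
      ≡⟨ ∑-cong (allVecs k elems) (λ xs → length-filter≡∑𝟙 (inStab? xs) allSelfMaps) ⟩
    ∑[ xs ∈ allVecs k elems ] ∑[ φ ∈ allSelfMaps ] 𝟙 (inStab? xs φ)
      ≡⟨ ∑-cong (allVecs k elems) (λ xs → ∑-cong allSelfMaps (λ φ → 𝟙-×-dec (isAut? φ) (fixes? φ xs))) ⟩
    ∑[ xs ∈ allVecs k elems ] ∑[ φ ∈ allSelfMaps ] (𝟙 (isAut? φ) * 𝟙 (fixes? φ xs))
      ≡⟨ ∑-comm (allVecs k elems) allSelfMaps _ ⟩
    ∑[ φ ∈ allSelfMaps ] ∑[ xs ∈ allVecs k elems ] (𝟙 (isAut? φ) * 𝟙 (fixes? φ xs))
      ≡⟨ ∑-cong allSelfMaps (λ φ → ∑-*ˡ (allVecs k elems) (𝟙 (isAut? φ)) (λ xs → 𝟙 (fixes? φ xs))) ⟩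
    ∑[ φ ∈ allSelfMaps ] (𝟙 (isAut? φ) * ∑[ xs ∈ allVecs k elems ] 𝟙 (fixes? φ xs))
      ≡⟨ ∑-cong allSelfMaps (λ φ → cong (𝟙 (isAut? φ) *_) (∑𝟙-all-allVecs (λ g → apply φ g ≟D g) k elems)) ⟩
    ∑ allSelfMaps weight ∎
    where
    open ≡-Reasoning
    fixes? : ∀ φ (xs : Vec (D p) k) → Dec (All (λ g → apply φ g ≡ g) (toList xs))
    fixes? φ xs = all? (λ g → apply φ g ≟D g) (toList xs)

  _≟κ_ : DecidableEquality (Fin p × Fin p)
  _≟κ_ = ≡-dec _≟ᶠ_ _≟ᶠ_

  fibre : Fin p × Fin p → ℕ
  fibre κ = ∑[ φ ∈ allSelfMaps ] (𝟙 (key φ ≟κ κ) * weight φ)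

  ρ≡∑fibre : ρ k ≡ ∑[ a ∈ allFin p ] ∑[ b ∈ allFin p ] fibre (a , b)
  ρ≡∑fibre = begin
    ρ k
      ≡⟨ ρ≡∑weight ⟩
    ∑ allSelfMaps weight
      ≡⟨ ∑-fibres _≟κ_ (cartesianProduct⁺ (allFin⁺ p) (allFin⁺ p)) key
                  (λ φ → ∈-cartesianProduct⁺ (∈-allFin _) (∈-allFin _)) allSelfMaps weight ⟩
    ∑ (cartesianProduct (allFin p) (allFin p)) fibre
      ≡⟨ ∑-cartesianProductWith _,_ (allFin p) (allFin p) fibre ⟩
    ∑[ a ∈ allFin p ] ∑[ b ∈ allFin p ] fibre (a , b) ∎
    where open ≡-Reasoning

  fibre-≥-shiftMap : ∀ b → fixCount (shiftMap b) ^ k ≤ fibre (proj₁ r , b)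
  fibre-≥-shiftMap b = begin
    fixCount (shiftMap b) ^ k
      ≡⟨ shiftMap-term ⟨
    𝟙 (key (shiftMap b) ≟κ κ) * weight (shiftMap b)
      ≤⟨ ∑-≥-∈ (λ φ → 𝟙 (key φ ≟κ κ) * weight φ) (∈-allSelfMaps (shiftMap b)) ⟩
    fibre κ ∎
    where
    open ≤-Reasoning
    κ = proj₁ r , b
    shiftMap-term : 𝟙 (key (shiftMap b) ≟κ κ) * weight (shiftMap b) ≡ fixCount (shiftMap b) ^ k
    shiftMap-term = begin-equality
      𝟙 (key (shiftMap b) ≟κ κ) * (𝟙 (isAut? (shiftMap b)) * fixCount (shiftMap b) ^ k)
        ≡⟨ cong₂ (λ x y → x * (y * fixCount (shiftMap b) ^ k))
                 (𝟙-yes (key (shiftMap b) ≟κ κ) (key-shiftMap b)) (𝟙-yes (isAut? (shiftMap b)) (shiftMap-isAut b)) ⟩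
      1 * (1 * fixCount (shiftMap b) ^ k)
        ≡⟨ trans (*-identityˡ _) (*-identityˡ _) ⟩
      fixCount (shiftMap b) ^ k ∎

  module _ (2<p : 2 < p) (isPrime : Prime p) where

    fibre-≤ : ∀ a b → fibre (a , b) ≤ fixBound (toℕ a) (toℕ b) ^ k
    fibre-≤ a b = begin
      fibre (a , b)
        ≡⟨ ∑-cong allSelfMaps regroup ⟩
      ∑[ φ ∈ allSelfMaps ] (𝟙 (in-fibre? φ) * fixCount φ ^ k)
        ≤⟨ ∑𝟙-≤-unique in-fibre? allSelfMaps-unique
             (λ (key-φ , aut-φ) (key-ψ , aut-ψ) → aut-determined-by-key 2<p aut-φ aut-ψ (trans key-φ (sym key-ψ)))
             (λ φ → fixCount φ ^ k) bound ⟩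
      fixBound (toℕ a) (toℕ b) ^ k ∎
      where
      open ≤-Reasoning
      in-fibre? : ∀ φ → Dec (key φ ≡ (a , b) × IsAut φ)
      in-fibre? φ = key φ ≟κ (a , b) ×-dec isAut? φ
      regroup : ∀ φ → 𝟙 (key φ ≟κ (a , b)) * weight φ ≡ 𝟙 (in-fibre? φ) * fixCount φ ^ k
      regroup φ = trans (sym (*-assoc (𝟙 (key φ ≟κ (a , b))) (𝟙 (isAut? φ)) (fixCount φ ^ k)))
                        (cong (_* fixCount φ ^ k) (sym (𝟙-×-dec (key φ ≟κ (a , b)) (isAut? φ))))
      bound : ∀ {φ} → key φ ≡ (a , b) × IsAut φ → fixCount φ ^ k ≤ fixBound (toℕ a) (toℕ b) ^ k
      bound (refl , aut) = ^-monoˡ-≤ k (aut-fixCount-≤ 2<p isPrime aut)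

^-distribʳ-* : ∀ m n o → (m * n) ^ o ≡ m ^ o * n ^ o
^-distribʳ-* m n zero    = refl
^-distribʳ-* m n (suc o) = begin
  m * n * (m * n) ^ o        ≡⟨ cong (m * n *_) (^-distribʳ-* m n o) ⟩
  m * n * (m ^ o * n ^ o)    ≡⟨ *-interchange m n (m ^ o) (n ^ o) ⟩
  m * m ^ o * (n * n ^ o)    ∎
  where open ≡-Reasoning

-- Writing p = q + 2 lets the sums over Fin p be unrolled past their first two terms.
module SumBounds (q k : ℕ) where

  p : ℕ
  p = suc (suc q)

  open Dihedral p
  open DihedralGroup p
  open Automorphisms p
  open Fibres p k

  ρ-≥ : (p * 2) ^ k + suc q * p ^ k ≤ ρ k
  ρ-≥ = begin
    (p * 2) ^ k + suc q * p ^ k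
      ≡⟨ cong ((p * 2) ^ k +_) (∑-allFin-const (suc q) (p ^ k)) ⟨
    (p * 2) ^ k + ∑[ _ ∈ allFin (suc q) ] (p ^ k)
      ≤⟨ +-mono-≤ (^-monoˡ-≤ k (fixCount-shiftMap-identity Fin.zero refl))
                  (∑-mono-≤ (allFin (suc q)) (λ b → ^-monoˡ-≤ k (fixCount-shiftMap (Fin.suc b)))) ⟩
    fixCount (shiftMap Fin.zero) ^ k + ∑[ b ∈ allFin (suc q) ] (fixCount (shiftMap (Fin.suc b)) ^ k)
      ≡⟨ ∑-allFin-suc (suc q) (λ b → fixCount (shiftMap b) ^ k) ⟨
    ∑[ b ∈ allFin p ] (fixCount (shiftMap b) ^ k)
      ≤⟨ ∑-mono-≤ (allFin p) fibre-≥-shiftMap ⟩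
    ∑[ b ∈ allFin p ] fibre (proj₁ r , b)
      ≤⟨ ∑-≥-∈ (λ a → ∑[ b ∈ allFin p ] fibre (a , b)) (∈-allFin (proj₁ r)) ⟩
    ∑[ a ∈ allFin p ] ∑[ b ∈ allFin p ] fibre (a , b)
      ≡⟨ ρ≡∑fibre ⟨
    ρ k ∎
    where open ≤-Reasoning

  module _ (2<p : 2 < p) (isPrime : Prime p) where

    ρ-≤ : ρ k ≤ (p * 2) ^ k + suc q * p ^ k + suc q * (p * 2 ^ k)
    ρ-≤ = begin
      ρ k
        ≡⟨ ρ≡∑fibre ⟩
      ∑[ a ∈ allFin p ] ∑[ b ∈ allFin p ] fibre (a , b)
        ≤⟨ ∑-mono-≤ (allFin p) (λ a → ∑-mono-≤ (allFin p) (fibre-≤ 2<p isPrime a)) ⟩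
      ∑[ a ∈ allFin p ] row (toℕ a)
        ≡⟨ ∑-allFin-suc (suc q) (λ a → row (toℕ a)) ⟩
      row 0 + ∑[ a ∈ allFin (suc q) ] row (suc (toℕ a))
        ≡⟨ cong (row 0 +_) (∑-allFin-suc q (λ a → row (suc (toℕ a)))) ⟩
      row 0 + (row 1 + ∑[ a ∈ allFin q ] row (2 + toℕ a))
        ≡⟨ cong₂ (λ x y → x + (row 1 + y)) row-0
                 (trans (∑-cong (allFin q) (λ a → row-2+ {toℕ a})) (∑-allFin-const q (p * 2 ^ k))) ⟩
      p * 2 ^ k + (row 1 + q * (p * 2 ^ k))
        ≡⟨ cong (λ x → p * 2 ^ k + (x + q * (p * 2 ^ k))) row-1 ⟩
      p * 2 ^ k + ((p * 2) ^ k + suc q * p ^ k + q * (p * 2 ^ k))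
        ≡⟨ rearrange (p * 2 ^ k) ((p * 2) ^ k + suc q * p ^ k) q ⟩
      (p * 2) ^ k + suc q * p ^ k + suc q * (p * 2 ^ k) ∎
      where
      open ≤-Reasoning
      row : ℕ → ℕ
      row a = ∑[ b ∈ allFin p ] (fixBound a (toℕ b) ^ k)
      row-0 : row 0 ≡ p * 2 ^ k
      row-0 = ∑-allFin-const p (2 ^ k)
      row-2+ : ∀ {a} → row (2 + a) ≡ p * 2 ^ k
      row-2+ = ∑-allFin-const p (2 ^ k)
      row-1 : row 1 ≡ (p * 2) ^ k + suc q * p ^ k
      row-1 = trans (∑-allFin-suc (suc q) (λ b → fixBound 1 (toℕ b) ^ k)) (cong ((p * 2) ^ k +_) (∑-allFin-const (suc q) (p ^ k)))
      rearrange : ∀ x y q → x + (y + q * x) ≡ y + suc q * x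
      rearrange = solve-∀

    ρ-upper : 2 ≤ k → ρ k ≤ p ^ k * ((p ∸ 1) + 2 ^ (k + 1))
    ρ-upper 2≤k = begin
      ρ k
        ≤⟨ ρ-≤ ⟩
      (p * 2) ^ k + suc q * p ^ k + suc q * (p * 2 ^ k)
        ≡⟨ cong₂ (λ x y → x + suc q * p ^ k + y) (sym (^-distribʳ-* p 2 k)) (*-assoc (suc q) p (2 ^ k)) ⟨
      p ^ k * 2 ^ k + suc q * p ^ k + suc q * p * 2 ^ k
        ≤⟨ +-monoʳ-≤ (p ^ k * 2 ^ k + suc q * p ^ k) (*-monoˡ-≤ (2 ^ k) [q+1]p≤p^k) ⟩
      p ^ k * 2 ^ k + suc q * p ^ k + p ^ k * 2 ^ k
        ≡⟨ collect (p ^ k) (2 ^ k) (suc q) ⟩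
      p ^ k * (suc q + 2 ^ k * 2)
        ≡⟨ cong (λ y → p ^ k * (suc q + y)) (^-distribˡ-+-* 2 k 1) ⟨
      p ^ k * ((p ∸ 1) + 2 ^ (k + 1)) ∎
      where
      open ≤-Reasoning
      [q+1]p≤p^k : suc q * p ≤ p ^ k
      [q+1]p≤p^k = begin
        suc q * p   ≤⟨ *-monoˡ-≤ p (n≤1+n (suc q)) ⟩
        p * p       ≡⟨ cong (p *_) (*-identityʳ p) ⟨
        p ^ 2       ≤⟨ ^-monoʳ-≤ p 2≤k ⟩
        p ^ k       ∎
      collect : ∀ x y c → x * y + c * x + x * y ≡ x * (c + y * 2)
      collect = solve-∀

  ρ-lower : p ^ k * ((p ∸ 1) + 2 ^ k) ≤ ρ k
  ρ-lower = ≤-trans (≤-reflexive (begin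
    p ^ k * (suc q + 2 ^ k)              ≡⟨ expand (p ^ k) (2 ^ k) (suc q) ⟩
    p ^ k * 2 ^ k + suc q * p ^ k        ≡⟨ cong (_+ suc q * p ^ k) (^-distribʳ-* p 2 k) ⟨
    (p * 2) ^ k + suc q * p ^ k          ∎)) ρ-≥
    where
    open ≡-Reasoning
    expand : ∀ x y c → x * (c + y) ≡ x * y + c * x
    expand = solve-∀

claim5p6 : (p : ℕ) .{{_ : NonZero p}} → Prime p → 3 < p → (k : ℕ) → 2 ≤ k →
    (p ^ k * ((p ∸ 1) + 2 ^ k) ≤ Dihedral.ρ p k)
    × (Dihedral.ρ p k ≤ p ^ k * ((p ∸ 1) + 2 ^ (k + 1)))
claim5p6 (suc (suc q)) isPrime 3<p k 2≤k = ρ-lower , ρ-upper (≤-trans (n≤1+n 3) 3<p) isPrime 2≤k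
  where open SumBounds q k
claim5p6 (suc zero) _ (s≤s ())
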